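{- For every $n\ge 1$, the triangulane $T_n$ satisfies $$Mo(T_n)=6\,(2^{n+2}-2^n)+\sum_{i=2}^{n}3\cdot 2^i\left(\Bigl(2^{n+2}+\sum_{t=0}^{i-2}2^{n-t}\Bigr)-2^{n-i+1}\right).$$
   Context: Circuit: for $m\ge 3$, pairwise disjoint connected graphs $H_1,\ldots,H_m$ and vertices $z_i\in V(H_i)$, the circuit of the $H_i$ with respect to the $z_i$ is obtained from the cycle $C_m$ with vertices $c_1,\ldots,c_m$ by identifying $z_i$ with $c_i$ for each $i$. Define graphs $G_k$ with a distinguished vertex $y_k$ recursively: $G_1$ is a triangle and $y_1$ is one of its vertices; for $k\ge 2$, $G_k$ is the circuit of two disjoint copies of $G_{k-1}$ and a single vertex $K_1$, with respect to the vertex $y_{k-1}$ in each copy and the vertex of $K_1$, and $y_k$ is the vertex of $K_1$. (Thus $G_k$ is a tree-like chain of triangles with $2^{k+1}-1$ vertices.) The triangulane $T_n$ is the circuit of three disjoint copies of $G_n$ with respect to $y_n$ in each copy, i.e., a central triangle with a copy of $G_n$ attached at each of its three vertices via $y_n$. For a graph $G$ and an edge $e=uv$, $n_u(e,G)$ denotes the number of vertices of $G$ strictly closer to $u$ than to $v$ (and $n_v(e,G)$ analogously). The Mostar index is $Mo(G)=\sum_{uv\in E(G)}|n_u(uv,G)-n_v(uv,G)|$. -}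

module Defs where

open import Data.Nat using (ℕ; zero; suc; _+_; _*_; _∸_; _^_; _<ᵇ_; ∣_-_∣)
open import Data.Bool using (Bool; true; false; _∧_; _∨_; if_then_else_)
open import Data.Fin using (Fin; _↑ˡ_; _↑ʳ_; _≟_) renaming (zero to fz; suc to fs)
open import Data.Fin.Base using ()
open import Data.List using (List; []; _∷_; _++_; map; zip; applyUpTo; allFin)
open import Data.Nat.ListAction using (sum)
open import Data.Bool.ListAction using (any)
open import Data.Vec using (Vec; toList; lookup) renaming ([] to []ᵥ; _∷_ to _∷ᵥ_; map to mapᵥ)
open import Data.Product using (Σ; _,_; _×_; proj₁; proj₂)
open import Relation.Nullary.Decidable using (⌊_⌋)

-- Finite simple graphs: vertices Fin V, an (undirected) edge list.

record Graph : Set where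
  field
    V : ℕ
    E : List (Fin V × Fin V)
open Graph public

record Pointed : Set where
  field
    G : Graph
    z : Fin (V G)
open Pointed public

emptyGraph : Graph
emptyGraph = record { V = 0 ; E = [] }

K1 : Pointed
K1 = record { G = record { V = 1 ; E = [] } ; z = fz }

union : Graph → Graph → Graph
union g h = record
  { V = V g + V h
  ; E = map (λ { (a , b) → (a ↑ˡ V h) , (b ↑ˡ V h) }) (E g)
     ++ map (λ { (a , b) → (V g ↑ʳ a) , (V g ↑ʳ b) }) (E h) }

unionAll : {m : ℕ} → Vec Pointed m → Σ Graph (λ g → Vec (Fin (V g)) m)
unionAll []ᵥ = emptyGraph , []ᵥ
unionAll (p ∷ᵥ ps) with unionAll ps
... | g , rs = union (G p) g , ((z p ↑ˡ V g) ∷ᵥ mapᵥ (V (G p) ↑ʳ_) rs)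

cycleEdges : {A : Set} → List A → List (A × A)
cycleEdges [] = []
cycleEdges (x ∷ xs) = zip (x ∷ xs) (xs ++ x ∷ [])

-- circuit of H_1..H_m w.r.t. z_1..z_m (identifying z_i with c_i of C_m)
circuitWithRoots : {m : ℕ} → Vec Pointed m → Σ Graph (λ g → Vec (Fin (V g)) m)
circuitWithRoots ps with unionAll ps
... | g , rs = record { V = V g ; E = E g ++ cycleEdges (toList rs) } , rs

-- the circuit (defined for m ≥ 3; the bound is a required argument)
circuit : {m : ℕ} → Vec Pointed m → 3 Data.Nat.≤ m → Graph
circuit ps _ = proj₁ (circuitWithRoots ps)

circuitAt : {m : ℕ} → (ps : Vec Pointed m) → 3 Data.Nat.≤ m → Fin m → Pointed
circuitAt ps _ i = record { G = proj₁ (circuitWithRoots ps) ; z = lookup (proj₂ (circuitWithRoots ps)) i }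

three≤three : 3 Data.Nat.≤ 3
three≤three = Data.Nat.s≤s (Data.Nat.s≤s (Data.Nat.s≤s Data.Nat.z≤n))

triangle : Pointed
triangle = record
  { G = record { V = 3 ; E = (fz , fs fz) ∷ (fs fz , fs (fs fz)) ∷ (fs (fs fz) , fz) ∷ [] }
  ; z = fz }

-- Gsuc k = G_{k+1} (with distinguished vertex y_{k+1})
Gsuc : ℕ → Pointed
Gsuc zero = triangle
Gsuc (suc k) = circuitAt (Gsuc k ∷ᵥ Gsuc k ∷ᵥ K1 ∷ᵥ []ᵥ) three≤three (fs (fs fz))

-- G_k for k ≥ 1 (G 0 is a junk value equal to G 1 and is never used)
Gk : ℕ → Pointed
Gk k = Gsuc (k ∸ 1)

T : ℕ → Graph
T n = circuit (Gk n ∷ᵥ Gk n ∷ᵥ Gk n ∷ᵥ []ᵥ) three≤three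

eqᵇ : {V : ℕ} → Fin V → Fin V → Bool
eqᵇ a b = ⌊ a ≟ b ⌋

reach : (g : Graph) → ℕ → Fin (V g) → Fin (V g) → Bool
reach g zero u w = eqᵇ u w
reach g (suc k) u w =
  reach g k u w ∨
  any (λ { (a , b) → (reach g k u a ∧ eqᵇ b w) ∨ (reach g k u b ∧ eqᵇ a w) }) (E g)

-- least k (searching k, k+1, ..., with fuel) with p k; returns k+fuel if none
firstTrue : (ℕ → Bool) → ℕ → ℕ → ℕ
firstTrue p k zero = k
firstTrue p k (suc f) = if p k then k else firstTrue p (suc k) f

-- graph distance d(u,w): least k with a walk of length k (≤ V-1 in a
-- connected graph); V g if w is unreachable from u
dist : (g : Graph) → Fin (V g) → Fin (V g) → ℕ
dist g u w = firstTrue (λ k → reach g k u w) 0 (V g)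

nClose : (g : Graph) → Fin (V g) → Fin (V g) → ℕ
nClose g u v = sum (map (λ w → if dist g u w <ᵇ dist g v w then 1 else 0) (allFin (V g)))

Mostar : Graph → ℕ
Mostar g = sum (map (λ { (u , v) → ∣ nClose g u v - nClose g v u ∣ }) (E g))

-- ∑_{i=a}^{b} f i  (empty if b < a)

∑[_⋯_] : ℕ → ℕ → (ℕ → ℕ) → ℕ
∑[ a ⋯ b ] f = sum (applyUpTo (λ j → f (a + j)) (suc b ∸ a))

-- G_{k+1} and T_n are circuits of three graphs, and in a circuit every shortest path between two
-- parts runs along the cycle. So for an edge inside a part H_i, the vertices of the other two parts
-- behave like extra weight hung at the root of H_i, and the Mostar index of a circuit splits into the
-- indices of its parts, each with such extra weight at its root, plus the three cycle edges.
-- Writing M_k(W) for the index of G_{k+1} with W extra vertices at y_{k+1}, this yields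
-- Mo(T_{k+1}) = 3 M_k(2 |G_{k+1}|) and M_{k+1}(W) = 2 M_k(|G_{k+1}| + 1 + W) + 2 (W + 1 - |G_{k+1}|)
-- for W + 1 ≥ |G_{k+1}|; moreover M_k is affine in W beyond |G_{k+1}|, with slope 2^{k+2} - 2.
-- Hence Mo(T_n) satisfies a linear recurrence in n, which the closed form satisfies as well.
module Submission where

open import Defs
open import Data.Bool using (Bool; true; false; _∧_; if_then_else_) renaming (T to IsTrue)
open import Data.Bool.Properties using (T-∨; T-∧; if-eta)
open import Data.Fin using (Fin; _↑ˡ_; _↑ʳ_) renaming (zero to fz; suc to fs)
import Data.Fin as Fin
import Data.Fin.Properties as FinP
open import Data.List using (List; []; _∷_; _++_; map; applyUpTo; allFin; tabulate)
open import Data.List.Membership.Propositional using (_∈_; find; lose)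
open import Data.List.Membership.Propositional.Properties using (∈-map⁺; ∈-map⁻; ∈-++⁺ˡ; ∈-++⁺ʳ; ∈-++⁻)
open import Data.List.Properties using (++-assoc; ++-identityʳ; map-++; map-∘; map-cong)
open import Data.List.Relation.Unary.Any using (here; there)
open import Data.List.Relation.Unary.Any.Properties using (any⁺; any⁻)
open import Data.Nat
open import Data.Nat.ListAction using (sum)
open import Data.Nat.ListAction.Properties using (sum-++)
open import Data.Nat.Properties
open import Algebra.Properties.Monoid.Sum +-0-monoid using (sum-cong-≗) renaming (sum to ∑)
open import Data.Nat.Tactic.RingSolver using (solve-∀)
open import Data.Product using (Σ; ∃-syntax; _×_; _,_; proj₁; proj₂)
open import Data.Sum using (_⊎_; inj₁; inj₂)
open import Data.Vec using () renaming ([] to []ᵥ; _∷_ to _∷ᵥ_)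
open import Function using (_∘_; Equivalence)
open import Relation.Binary.PropositionalEquality
open import Relation.Nullary using (Dec; yes; no; contradiction)
open import Relation.Nullary.Decidable using (⌊_⌋; toWitness; fromWitness)

open Equivalence using (to; from)

Adjacent : (g : Graph) → Fin (V g) → Fin (V g) → Set
Adjacent g a b = (a , b) ∈ E g ⊎ (b , a) ∈ E g

record IsDistanceFrom (g : Graph) (u : Fin (V g)) (D : Fin (V g) → ℕ) : Set where
  field
    root-zero   : D u ≡ 0
    zero⇒root   : ∀ w → D w ≡ 0 → w ≡ u
    1-lipschitz : ∀ {a b} → Adjacent g a b → D b ≤ suc (D a)
    predecessor : ∀ w k → D w ≡ suc k → ∃[ w′ ] Adjacent g w′ w × D w′ ≡ k
    bounded     : ∀ w → D w < V g

-- dist g u w is V g when w is unreachable, so the bound in IsDistanceFrom makes this connectivity.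
Connected : Graph → Set
Connected g = ∀ u → IsDistanceFrom g u (dist g u)

eqᵇ-sound : ∀ {n} (a b : Fin n) → IsTrue (eqᵇ a b) → a ≡ b
eqᵇ-sound a b = toWitness {a? = a Fin.≟ b}

eqᵇ-refl : ∀ {n} (a : Fin n) → IsTrue (eqᵇ a a)
eqᵇ-refl a = fromWitness {a? = a Fin.≟ a} refl

module _ {g : Graph} {u : Fin (V g)} {D : Fin (V g) → ℕ} (cert : IsDistanceFrom g u D) where
  open IsDistanceFrom cert

  reach-sound : ∀ k w → IsTrue (reach g k u w) → D w ≤ k
  reach-sound zero w r with refl ← eqᵇ-sound u w r = ≤-reflexive root-zero
  reach-sound (suc k) w r with to (T-∨ {reach g k u w}) r
  ... | inj₁ r′ = m≤n⇒m≤1+n (reach-sound k w r′)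
  ... | inj₂ r′ with find (any⁻ _ (E g) r′)
  ... | (a , b) , e , s with to (T-∨ {reach g k u a ∧ eqᵇ b w}) s
  ... | inj₁ s′ with r″ , b≡w ← to (T-∧ {reach g k u a}) s′ with refl ← eqᵇ-sound b w b≡w =
    ≤-trans (1-lipschitz (inj₁ e)) (s≤s (reach-sound k a r″))
  ... | inj₂ s′ with r″ , a≡w ← to (T-∧ {reach g k u b}) s′ with refl ← eqᵇ-sound a w a≡w =
    ≤-trans (1-lipschitz (inj₂ e)) (s≤s (reach-sound k b r″))

  reach-complete : ∀ k w → D w ≤ k → IsTrue (reach g k u w)
  reach-complete zero w Dw≤0 = fromWitness {a? = u Fin.≟ w} (sym (zero⇒root w (n≤0⇒n≡0 Dw≤0)))
  reach-complete (suc k) w Dw≤1+k with m≤n⇒m<n∨m≡n Dw≤1+k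
  ... | inj₁ Dw<1+k = from (T-∨ {reach g k u w}) (inj₁ (reach-complete k w (≤-pred Dw<1+k)))
  ... | inj₂ Dw≡1+k with predecessor w k Dw≡1+k
  ... | w′ , inj₁ e , Dw′≡k = from (T-∨ {reach g k u w}) (inj₂ (any⁺ _ (lose e
          (from (T-∨ {reach g k u w′ ∧ eqᵇ w w}) (inj₁ (from T-∧ (reach-complete k w′ (≤-reflexive Dw′≡k) , eqᵇ-refl w)))))))
  ... | w′ , inj₂ e , Dw′≡k = from (T-∨ {reach g k u w}) (inj₂ (any⁺ _ (lose e
          (from (T-∨ {reach g k u w ∧ eqᵇ w′ w}) (inj₂ (from T-∧ (reach-complete k w′ (≤-reflexive Dw′≡k) , eqᵇ-refl w)))))))

firstTrue-characterised : (p : ℕ → Bool) (d : ℕ) → (∀ k → IsTrue (p k) → d ≤ k) → (∀ k → d ≤ k → IsTrue (p k)) →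
  ∀ k f → k ≤ d → d ≤ k + f → firstTrue p k f ≡ d
firstTrue-characterised p d least holds k zero k≤d d≤k+0 = ≤-antisym k≤d (subst (d ≤_) (+-identityʳ k) d≤k+0)
firstTrue-characterised p d least holds k (suc f) k≤d d≤k+1+f with m≤n⇒m<n∨m≡n k≤d
... | inj₂ refl with p k | holds k ≤-refl
...   | true  | _  = refl
...   | false | ()
firstTrue-characterised p d least holds k (suc f) k≤d d≤k+1+f | inj₁ k<d with p k in pk
... | true = contradiction (least k (subst IsTrue (sym pk) _)) (<⇒≱ k<d)
... | false = firstTrue-characterised p d least holds (suc k) f k<d (subst (d ≤_) (+-suc k f) d≤k+1+f)

dist-unique : ∀ {g u D} → IsDistanceFrom g u D → ∀ w → dist g u w ≡ D w
dist-unique {g} {u} {D} cert w =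
  firstTrue-characterised (λ k → reach g k u w) (D w) (λ k → reach-sound cert k w) (λ k → reach-complete cert k w)
    0 (V g) z≤n (<⇒≤ (IsDistanceFrom.bounded cert w))

IsDistanceFrom-resp : ∀ {g u D D′} → (∀ w → D w ≡ D′ w) → IsDistanceFrom g u D → IsDistanceFrom g u D′
IsDistanceFrom-resp {g} {u} {D} {D′} D≗D′ cert = record
  { root-zero   = trans (sym (D≗D′ u)) root-zero
  ; zero⇒root   = λ w D′w≡0 → zero⇒root w (trans (D≗D′ w) D′w≡0)
  ; 1-lipschitz = λ {a} {b} adj → subst₂ (λ x y → x ≤ suc y) (D≗D′ b) (D≗D′ a) (1-lipschitz adj)
  ; predecessor = λ w k D′w≡1+k → let (w′ , adj , Dw′≡k) = predecessor w k (trans (D≗D′ w) D′w≡1+k)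
                                  in w′ , adj , trans (sym (D≗D′ w′)) Dw′≡k
  ; bounded     = λ w → subst (_< V g) (D≗D′ w) (bounded w) }
  where open IsDistanceFrom cert

dist-isDistanceFrom : ∀ {g u D} → IsDistanceFrom g u D → IsDistanceFrom g u (dist g u)
dist-isDistanceFrom cert = IsDistanceFrom-resp (λ w → sym (dist-unique cert w)) cert

⟦_<_⟧ : ℕ → ℕ → ℕ
⟦ a < b ⟧ = if a <ᵇ b then 1 else 0

+-cancelˡ-<ᵇ : ∀ c a b → (c + a <ᵇ c + b) ≡ (a <ᵇ b)
+-cancelˡ-<ᵇ zero    a b = refl
+-cancelˡ-<ᵇ (suc c) a b = +-cancelˡ-<ᵇ c a b

+-cancelʳ-<ᵇ : ∀ a b c → (a + c <ᵇ b + c) ≡ (a <ᵇ b)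
+-cancelʳ-<ᵇ a b c = trans (cong₂ _<ᵇ_ (+-comm a c) (+-comm b c)) (+-cancelˡ-<ᵇ c a b)

sum-map-tabulate : ∀ {A : Set} n (h : Fin n → A) (f : A → ℕ) → sum (map f (tabulate h)) ≡ ∑ (f ∘ h)
sum-map-tabulate zero    h f = refl
sum-map-tabulate (suc n) h f = cong (f (h fz) +_) (sum-map-tabulate n (h ∘ fs) f)

sum-map-allFin : ∀ n (f : Fin n → ℕ) → sum (map f (allFin n)) ≡ ∑ f
sum-map-allFin n = sum-map-tabulate n (λ w → w)

∑-↑ : ∀ m n (f : Fin (m + n) → ℕ) → ∑ f ≡ ∑ (f ∘ (_↑ˡ n)) + ∑ (f ∘ (m ↑ʳ_))
∑-↑ zero    n f = refl
∑-↑ (suc m) n f = trans (cong (f fz +_) (∑-↑ m n (f ∘ fs))) (sym (+-assoc (f fz) _ _))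

∑-if-const : ∀ n c → ∑ {n} (λ _ → if c then 1 else 0) ≡ (if c then n else 0)
∑-if-const zero    true  = refl
∑-if-const zero    false = refl
∑-if-const (suc n) true  = cong suc (∑-if-const n true)
∑-if-const (suc n) false = ∑-if-const n false

∑-shifted-indicator : ∀ n a b (t : Fin n → ℕ) → ∑ (λ w → ⟦ a + t w < b + t w ⟧) ≡ (if a <ᵇ b then n else 0)
∑-shifted-indicator n a b t =
  trans (sum-cong-≗ (λ w → cong (λ c → if c then 1 else 0) (+-cancelʳ-<ᵇ a b (t w)))) (∑-if-const n (a <ᵇ b))

-- The Mostar index of g after hanging W extra vertices at z: they lie on a's side of ab iff d(a,z) < d(b,z).
closerWith : (g : Graph) → Fin (V g) → ℕ → Fin (V g) → Fin (V g) → ℕ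
closerWith g z W a b = nClose g a b + (if dist g a z <ᵇ dist g b z then W else 0)

imbalanceWith : (g : Graph) → Fin (V g) → ℕ → Fin (V g) × Fin (V g) → ℕ
imbalanceWith g z W (a , b) = ∣ closerWith g z W a b - closerWith g z W b a ∣

mostarWith : (g : Graph) → Fin (V g) → ℕ → ℕ
mostarWith g z W = sum (map (imbalanceWith g z W) (E g))

sum-map-++ : ∀ {A : Set} (f : A → ℕ) xs ys → sum (map f (xs ++ ys)) ≡ sum (map f xs) + sum (map f ys)
sum-map-++ f xs ys = trans (cong sum (map-++ f xs ys)) (sum-++ (map f xs) _)

mostar≡mostarWith-0 : ∀ g z → Mostar g ≡ mostarWith g z 0
mostar≡mostarWith-0 g z = cong sum (map-cong (λ (a , b) → cong₂ ∣_-_∣ (closer a b) (closer b a)) (E g))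
  where closer : ∀ a b → nClose g a b ≡ closerWith g z 0 a b
        closer a b = sym (trans (cong (nClose g a b +_) (if-eta (dist g a z <ᵇ dist g b z))) (+-identityʳ _))

data Three : Set where
  i₁ i₂ i₃ : Three

_≟₃_ : (i j : Three) → Dec (i ≡ j)
i₁ ≟₃ i₁ = yes refl
i₁ ≟₃ i₂ = no λ ()
i₁ ≟₃ i₃ = no λ ()
i₂ ≟₃ i₁ = no λ ()
i₂ ≟₃ i₂ = yes refl
i₂ ≟₃ i₃ = no λ ()
i₃ ≟₃ i₁ = no λ ()
i₃ ≟₃ i₂ = no λ ()
i₃ ≟₃ i₃ = yes refl

∑₃ : (Three → ℕ) → ℕ
∑₃ f = f i₁ + (f i₂ + (f i₃ + 0))

hop : Three → Three → ℕ
hop i j = if ⌊ i ≟₃ j ⌋ then 0 else 1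

hop-<ᵇ : ∀ i j ρ → i ≢ j → (hop i ρ <ᵇ hop j ρ) ≡ ⌊ i ≟₃ ρ ⌋
hop-<ᵇ i j ρ i≢j with i ≟₃ ρ | j ≟₃ ρ
... | yes refl | yes refl = contradiction refl i≢j
... | yes _    | no _     = refl
... | no _     | yes _    = refl
... | no _     | no _     = refl

module Circuit₃ (P₁ P₂ P₃ : Pointed) where

  g : Graph
  g = proj₁ (circuitWithRoots (P₁ ∷ᵥ P₂ ∷ᵥ P₃ ∷ᵥ []ᵥ))

  P : Three → Pointed
  P i₁ = P₁
  P i₂ = P₂
  P i₃ = P₃

  H : Three → Graph
  H i = G (P i)

  size : Three → ℕ
  size i = V (H i)

  root : (i : Three) → Fin (size i)
  root i = z (P i)

  others : Three → ℕ
  others i₁ = size i₂ + size i₃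
  others i₂ = size i₁ + size i₃
  others i₃ = size i₁ + size i₂

  ι : (i : Three) → Fin (size i) → Fin (V g)
  ι i₁ x = x ↑ˡ (size i₂ + (size i₃ + 0))
  ι i₂ x = size i₁ ↑ʳ (x ↑ˡ (size i₃ + 0))
  ι i₃ x = size i₁ ↑ʳ (size i₂ ↑ʳ (x ↑ˡ 0))

  c : Three → Fin (V g)
  c i = ι i (root i)

  Vertex : Set
  Vertex = Σ Three (λ i → Fin (size i))

  decode : Fin (V g) → Vertex
  decode w with Fin.splitAt (size i₁) w
  ... | inj₁ x = i₁ , x
  ... | inj₂ w′ with Fin.splitAt (size i₂) w′
  ...   | inj₁ x = i₂ , x
  ...   | inj₂ w″ with Fin.splitAt (size i₃) w″
  ...     | inj₁ x = i₃ , x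
  ...     | inj₂ ()

  decode-ι : ∀ i x → decode (ι i x) ≡ (i , x)
  decode-ι i₁ x rewrite FinP.splitAt-↑ˡ (size i₁) x (size i₂ + (size i₃ + 0)) = refl
  decode-ι i₂ x rewrite FinP.splitAt-↑ʳ (size i₁) (size i₂ + (size i₃ + 0)) (x ↑ˡ (size i₃ + 0))
                      | FinP.splitAt-↑ˡ (size i₂) x (size i₃ + 0) = refl
  decode-ι i₃ x rewrite FinP.splitAt-↑ʳ (size i₁) (size i₂ + (size i₃ + 0)) (size i₂ ↑ʳ (x ↑ˡ 0))
                      | FinP.splitAt-↑ʳ (size i₂) (size i₃ + 0) (x ↑ˡ 0)
                      | FinP.splitAt-↑ˡ (size i₃) x 0 = refl

  ι-decode : ∀ w → ι (proj₁ (decode w)) (proj₂ (decode w)) ≡ w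
  ι-decode w with Fin.splitAt (size i₁) w in e₁
  ... | inj₁ x = FinP.splitAt⁻¹-↑ˡ e₁
  ... | inj₂ w′ with Fin.splitAt (size i₂) w′ in e₂
  ...   | inj₁ x = trans (cong (size i₁ ↑ʳ_) (FinP.splitAt⁻¹-↑ˡ e₂)) (FinP.splitAt⁻¹-↑ʳ e₁)
  ...   | inj₂ w″ with Fin.splitAt (size i₃) w″ in e₃
  ...     | inj₁ x = trans (cong (λ v → size i₁ ↑ʳ (size i₂ ↑ʳ v)) (FinP.splitAt⁻¹-↑ˡ e₃))
                       (trans (cong (size i₁ ↑ʳ_) (FinP.splitAt⁻¹-↑ʳ e₂)) (FinP.splitAt⁻¹-↑ʳ e₁))
  ...     | inj₂ ()

  ∀-vertex : {Q : Fin (V g) → Set} → (∀ i y → Q (ι i y)) → ∀ w → Q w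
  ∀-vertex {Q} q w = subst Q (ι-decode w) (q (proj₁ (decode w)) (proj₂ (decode w)))

  lift : (i : Three) → Fin (size i) × Fin (size i) → Fin (V g) × Fin (V g)
  lift i (a , b) = ι i a , ι i b

  liftedEdges : Three → List (Fin (V g) × Fin (V g))
  liftedEdges i = map (lift i) (E (H i))

  cycle : List (Fin (V g) × Fin (V g))
  cycle = (c i₁ , c i₂) ∷ (c i₂ , c i₃) ∷ (c i₃ , c i₁) ∷ []

  edges : E g ≡ liftedEdges i₁ ++ liftedEdges i₂ ++ liftedEdges i₃ ++ cycle
  edges = begin
      (map L₁ (E (H i₁)) ++ map R₁ (map L₂ (E (H i₂)) ++ map R₂ (map L₃ (E (H i₃)) ++ []))) ++ cycle
    ≡⟨ ++-assoc (map L₁ (E (H i₁))) _ cycle ⟩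
      liftedEdges i₁ ++ map R₁ (map L₂ (E (H i₂)) ++ map R₂ (map L₃ (E (H i₃)) ++ [])) ++ cycle
    ≡⟨ cong (λ es → liftedEdges i₁ ++ es ++ cycle) part₂₃ ⟩
      liftedEdges i₁ ++ (liftedEdges i₂ ++ liftedEdges i₃) ++ cycle
    ≡⟨ cong (liftedEdges i₁ ++_) (++-assoc (liftedEdges i₂) _ cycle) ⟩
      liftedEdges i₁ ++ liftedEdges i₂ ++ liftedEdges i₃ ++ cycle
    ∎
    where
      open ≡-Reasoning
      L₁ = λ (e : Fin (size i₁) × Fin (size i₁)) → (proj₁ e ↑ˡ (size i₂ + (size i₃ + 0))) , (proj₂ e ↑ˡ (size i₂ + (size i₃ + 0)))
      L₂ = λ (e : Fin (size i₂) × Fin (size i₂)) → (proj₁ e ↑ˡ (size i₃ + 0)) , (proj₂ e ↑ˡ (size i₃ + 0))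
      L₃ = λ (e : Fin (size i₃) × Fin (size i₃)) → (proj₁ e ↑ˡ 0) , (proj₂ e ↑ˡ 0)
      R₁ = λ (e : Fin (size i₂ + (size i₃ + 0)) × Fin (size i₂ + (size i₃ + 0))) → (size i₁ ↑ʳ proj₁ e) , (size i₁ ↑ʳ proj₂ e)
      R₂ = λ (e : Fin (size i₃ + 0) × Fin (size i₃ + 0)) → (size i₂ ↑ʳ proj₁ e) , (size i₂ ↑ʳ proj₂ e)
      part₂₃ : map R₁ (map L₂ (E (H i₂)) ++ map R₂ (map L₃ (E (H i₃)) ++ [])) ≡ liftedEdges i₂ ++ liftedEdges i₃
      part₂₃ = begin
          map R₁ (map L₂ (E (H i₂)) ++ map R₂ (map L₃ (E (H i₃)) ++ []))
        ≡⟨ map-++ R₁ (map L₂ (E (H i₂))) _ ⟩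
          map R₁ (map L₂ (E (H i₂))) ++ map R₁ (map R₂ (map L₃ (E (H i₃)) ++ []))
        ≡⟨ cong₂ _++_ (sym (map-∘ (E (H i₂)))) (cong (map R₁ ∘ map R₂) (++-identityʳ _)) ⟩
          liftedEdges i₂ ++ map R₁ (map R₂ (map L₃ (E (H i₃))))
        ≡⟨ cong (liftedEdges i₂ ++_) (trans (sym (map-∘ _)) (sym (map-∘ (E (H i₃))))) ⟩
          liftedEdges i₂ ++ liftedEdges i₃
        ∎

  lift-∈ : ∀ i {a b} → (a , b) ∈ E (H i) → (ι i a , ι i b) ∈ E g
  lift-∈ i {a} {b} e = subst ((ι i a , ι i b) ∈_) (sym edges) (into i (∈-map⁺ (lift i) e))
    where
      into : ∀ i {e} → e ∈ liftedEdges i →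
             e ∈ liftedEdges i₁ ++ liftedEdges i₂ ++ liftedEdges i₃ ++ cycle
      into i₁ m = ∈-++⁺ˡ m
      into i₂ m = ∈-++⁺ʳ (liftedEdges i₁) (∈-++⁺ˡ m)
      into i₃ m = ∈-++⁺ʳ (liftedEdges i₁) (∈-++⁺ʳ (liftedEdges i₂) (∈-++⁺ˡ m))

  cycle-∈ : ∀ {e} → e ∈ cycle → e ∈ E g
  cycle-∈ {e} m = subst (e ∈_) (sym edges)
    (∈-++⁺ʳ (liftedEdges i₁) (∈-++⁺ʳ (liftedEdges i₂) (∈-++⁺ʳ (liftedEdges i₃) m)))

  c-adjacent : ∀ i j → i ≢ j → Adjacent g (c i) (c j)
  c-adjacent i₁ i₁ i≢j = contradiction refl i≢j
  c-adjacent i₁ i₂ _ = inj₁ (cycle-∈ (here refl))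
  c-adjacent i₁ i₃ _ = inj₂ (cycle-∈ (there (there (here refl))))
  c-adjacent i₂ i₁ _ = inj₂ (cycle-∈ (here refl))
  c-adjacent i₂ i₂ i≢j = contradiction refl i≢j
  c-adjacent i₂ i₃ _ = inj₁ (cycle-∈ (there (here refl)))
  c-adjacent i₃ i₁ _ = inj₁ (cycle-∈ (there (there (here refl))))
  c-adjacent i₃ i₂ _ = inj₂ (cycle-∈ (there (here refl)))
  c-adjacent i₃ i₃ i≢j = contradiction refl i≢j

  data EdgeView : Fin (V g) → Fin (V g) → Set where
    inner  : ∀ i {a b} → (a , b) ∈ E (H i) → EdgeView (ι i a) (ι i b)
    cyclic : ∀ i j → EdgeView (c i) (c j)

  edge-view : ∀ {a b} → (a , b) ∈ E g → EdgeView a b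
  edge-view m with ∈-++⁻ (liftedEdges i₁) (subst (_ ∈_) edges m)
  ... | inj₁ m₁ with (_ , _) , e , refl ← ∈-map⁻ (lift i₁) m₁ = inner i₁ e
  ... | inj₂ m₁ with ∈-++⁻ (liftedEdges i₂) m₁
  ...   | inj₁ m₂ with (_ , _) , e , refl ← ∈-map⁻ (lift i₂) m₂ = inner i₂ e
  ...   | inj₂ m₂ with ∈-++⁻ (liftedEdges i₃) m₂
  ...     | inj₁ m₃ with (_ , _) , e , refl ← ∈-map⁻ (lift i₃) m₃ = inner i₃ e
  ...     | inj₂ (here refl) = cyclic i₁ i₂
  ...     | inj₂ (there (here refl)) = cyclic i₂ i₃
  ...     | inj₂ (there (there (here refl))) = cyclic i₃ i₁

  size+others : ∀ i → size i + others i ≡ V g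
  size+others i₁ = arrange₁ (size i₁) (size i₂) (size i₃)
    where arrange₁ : ∀ a b c → a + (b + c) ≡ a + (b + (c + 0))
          arrange₁ = solve-∀
  size+others i₂ = arrange₂ (size i₁) (size i₂) (size i₃)
    where arrange₂ : ∀ a b c → b + (a + c) ≡ a + (b + (c + 0))
          arrange₂ = solve-∀
  size+others i₃ = arrange₃ (size i₁) (size i₂) (size i₃)
    where arrange₃ : ∀ a b c → c + (a + b) ≡ a + (b + (c + 0))
          arrange₃ = solve-∀

  size≤others : ∀ k i → k ≢ i → size i ≤ others k
  size≤others i₁ i₁ k≢i = contradiction refl k≢i
  size≤others i₁ i₂ _ = m≤m+n _ _
  size≤others i₁ i₃ _ = m≤n+m _ _
  size≤others i₂ i₁ _ = m≤m+n _ _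
  size≤others i₂ i₂ k≢i = contradiction refl k≢i
  size≤others i₂ i₃ _ = m≤n+m _ _
  size≤others i₃ i₁ _ = m≤m+n _ _
  size≤others i₃ i₂ _ = m≤n+m _ _
  size≤others i₃ i₃ k≢i = contradiction refl k≢i

  ∑₃-focus : ∀ i (f : Three → ℕ) N b → f i ≡ N → (∀ k → k ≢ i → f k ≡ (if b then size k else 0)) →
             ∑₃ f ≡ N + (if b then others i else 0)
  ∑₃-focus i₁ f N b fi≡N fk rewrite fi≡N | fk i₂ (λ ()) | fk i₃ (λ ()) with b
  ... | true  = cong (λ n → N + (size i₂ + n)) (+-identityʳ (size i₃))
  ... | false = refl
  ∑₃-focus i₂ f N b fi≡N fk rewrite fi≡N | fk i₁ (λ ()) | fk i₃ (λ ()) with b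
  ... | true  = arrange (size i₁) N (size i₃)
    where arrange : ∀ a n c → a + (n + (c + 0)) ≡ n + (a + c)
          arrange = solve-∀
  ... | false = refl
  ∑₃-focus i₃ f N b fi≡N fk rewrite fi≡N | fk i₁ (λ ()) | fk i₂ (λ ()) with b
  ... | true  = arrange (size i₁) (size i₂) N
    where arrange : ∀ a c n → a + (c + (n + 0)) ≡ n + (a + c)
          arrange = solve-∀
  ... | false = refl

  ∑₃-cycle : ∀ i j → i ≢ j → ∑₃ (λ k → if hop i k <ᵇ hop j k then size k else 0) ≡ size i
  ∑₃-cycle i₁ i₁ i≢j = contradiction refl i≢j
  ∑₃-cycle i₁ i₂ _ = +-identityʳ _
  ∑₃-cycle i₁ i₃ _ = +-identityʳ _
  ∑₃-cycle i₂ i₁ _ = +-identityʳ _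
  ∑₃-cycle i₂ i₂ i≢j = contradiction refl i≢j
  ∑₃-cycle i₂ i₃ _ = +-identityʳ _
  ∑₃-cycle i₃ i₁ _ = +-identityʳ _
  ∑₃-cycle i₃ i₂ _ = +-identityʳ _
  ∑₃-cycle i₃ i₃ i≢j = contradiction refl i≢j

  partMostar : ℕ → Three → ℕ
  partMostar W i = mostarWith (H i) (root i) (others i + W)

  side : Three → ℕ → Three → ℕ
  side ρ W i = size i + (if ⌊ i ≟₃ ρ ⌋ then W else 0)

  cycleImbalance : Three → ℕ → ℕ
  cycleImbalance ρ W = ∣ side ρ W i₁ - side ρ W i₂ ∣ + (∣ side ρ W i₂ - side ρ W i₃ ∣ + (∣ side ρ W i₃ - side ρ W i₁ ∣ + 0))

  parts-connected : Connected (G P₁) → Connected (G P₂) → Connected (G P₃) → ∀ i → Connected (H i)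
  parts-connected c₁ _ _ i₁ = c₁
  parts-connected _ c₂ _ i₂ = c₂
  parts-connected _ _ c₃ i₃ = c₃

  module Distances (c₁ : Connected (G P₁)) (c₂ : Connected (G P₂)) (c₃ : Connected (G P₃)) where

    connected : ∀ i → Connected (H i)
    connected = parts-connected c₁ c₂ c₃

    d : (i : Three) → Fin (size i) → Fin (size i) → ℕ
    d i = dist (H i)

    d-root : ∀ i → d i (root i) (root i) ≡ 0
    d-root i = IsDistanceFrom.root-zero (connected i (root i))

    -- A shortest path between different parts leaves through c_k and enters through c_i, which are adjacent.
    δ : Vertex → Vertex → ℕ
    δ (k , x) (i , y) with k ≟₃ i
    ... | yes refl = d k x y
    ... | no _     = d k x (root k) + suc (d i (root i) y)

    δ-same : ∀ k x y → δ (k , x) (k , y) ≡ d k x y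
    δ-same k x y with k ≟₃ k
    ... | yes refl = refl
    ... | no k≢k   = contradiction refl k≢k

    δ-cross : ∀ k i x y → k ≢ i → δ (k , x) (i , y) ≡ d k x (root k) + suc (d i (root i) y)
    δ-cross k i x y k≢i with k ≟₃ i
    ... | yes refl = contradiction refl k≢i
    ... | no _     = refl

    δ-to-root : ∀ k x i → δ (k , x) (i , root i) ≡ d k x (root k) ⊎ δ (k , x) (i , root i) ≡ suc (d k x (root k))
    δ-to-root k x i with k ≟₃ i
    ... | yes refl = inj₁ refl
    ... | no _     = inj₂ (trans (cong (λ n → d k x (root k) + suc n) (d-root i)) (+-comm _ 1))

    δ-lipschitz-inner : ∀ k x i {a b} → Adjacent (H i) a b → δ (k , x) (i , b) ≤ suc (δ (k , x) (i , a))
    δ-lipschitz-inner k x i adj with k ≟₃ i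
    ... | yes refl = IsDistanceFrom.1-lipschitz (connected k x) adj
    ... | no _     = ≤-trans (+-monoʳ-≤ (d k x (root k)) (s≤s (IsDistanceFrom.1-lipschitz (connected i (root i)) adj)))
                             (≤-reflexive (+-suc (d k x (root k)) _))

    δ-bounded : ∀ k x i y → δ (k , x) (i , y) < V g
    δ-bounded k x i y with k ≟₃ i
    ... | yes refl = ≤-trans (IsDistanceFrom.bounded (connected k x) y)
                       (subst (size k ≤_) (size+others k) (m≤m+n (size k) (others k)))
    ... | no k≢i   = ≤-trans (+-mono-<-≤ (IsDistanceFrom.bounded (connected k x) (root k))
                                         (IsDistanceFrom.bounded (connected i (root i)) y))
                       (subst (size k + size i ≤_) (size+others k) (+-monoʳ-≤ (size k) (size≤others k i k≢i)))

    D : ∀ k → Fin (size k) → Fin (V g) → ℕ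
    D k x w = δ (k , x) (decode w)

    D-ι : ∀ k x i y → D k x (ι i y) ≡ δ (k , x) (i , y)
    D-ι k x i y = cong (δ (k , x)) (decode-ι i y)

    δ-zero⇒source : ∀ k x i y → δ (k , x) (i , y) ≡ 0 → ι i y ≡ ι k x
    δ-zero⇒source k x i y δ≡0 with k ≟₃ i
    ... | yes refl = cong (ι k) (IsDistanceFrom.zero⇒root (connected k x) y δ≡0)
    ... | no _     = contradiction (trans (sym (+-suc (d k x (root k)) _)) δ≡0) λ ()

    D-lipschitz : ∀ k x {a b} → EdgeView a b → D k x b ≤ suc (D k x a) × D k x a ≤ suc (D k x b)
    D-lipschitz k x (inner i {a} {b} e) rewrite D-ι k x i a | D-ι k x i b =
      δ-lipschitz-inner k x i (inj₁ e) , δ-lipschitz-inner k x i (inj₂ e)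
    D-lipschitz k x (cyclic i j) rewrite D-ι k x i (root i) | D-ι k x j (root j) =
      near (δ-to-root k x j) (δ-to-root k x i) , near (δ-to-root k x i) (δ-to-root k x j)
      where
        near : ∀ {m n A} → m ≡ A ⊎ m ≡ suc A → n ≡ A ⊎ n ≡ suc A → m ≤ suc n
        near (inj₁ refl) (inj₁ refl) = n≤1+n _
        near (inj₁ refl) (inj₂ refl) = m≤n⇒m≤1+n (n≤1+n _)
        near (inj₂ refl) (inj₁ refl) = ≤-refl
        near (inj₂ refl) (inj₂ refl) = n≤1+n _

    lift-adjacent : ∀ i {a b} → Adjacent (H i) a b → Adjacent g (ι i a) (ι i b)
    lift-adjacent i (inj₁ e) = inj₁ (lift-∈ i e)
    lift-adjacent i (inj₂ e) = inj₂ (lift-∈ i e)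

    δ-predecessor : ∀ k x i y m → δ (k , x) (i , y) ≡ suc m → ∃[ w′ ] Adjacent g w′ (ι i y) × D k x w′ ≡ m
    δ-predecessor k x i y m δ≡1+m with k ≟₃ i
    ... | yes refl =
      let y′ , adj , d≡m = IsDistanceFrom.predecessor (connected k x) y m δ≡1+m
      in ι k y′ , lift-adjacent k adj , trans (D-ι k x k y′) (trans (δ-same k x y′) d≡m)
    ... | no k≢i with d i (root i) y in d≡
    ...   | zero =
      c k , subst (λ t → Adjacent g (c k) (ι i t)) (sym (IsDistanceFrom.zero⇒root (connected i (root i)) y d≡)) (c-adjacent k i k≢i)
          , trans (D-ι k x k (root k)) (trans (δ-same k x (root k)) (suc-injective (trans (+-comm 1 _) δ≡1+m)))
    ...   | suc n =
      let y′ , adj , d≡n = IsDistanceFrom.predecessor (connected i (root i)) y n d≡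
      in ι i y′ , lift-adjacent i adj
       , trans (D-ι k x i y′) (trans (δ-cross k i x y′ k≢i)
           (trans (cong (λ t → d k x (root k) + suc t) d≡n) (suc-injective (trans (sym (+-suc (d k x (root k)) (suc n))) δ≡1+m))))

    D-isDistanceFrom : ∀ k x → IsDistanceFrom g (ι k x) (D k x)
    D-isDistanceFrom k x = record
      { root-zero   = trans (D-ι k x k x) (trans (δ-same k x x) (IsDistanceFrom.root-zero (connected k x)))
      ; zero⇒root   = ∀-vertex (λ i y D≡0 → δ-zero⇒source k x i y (trans (sym (D-ι k x i y)) D≡0))
      ; 1-lipschitz = λ { (inj₁ e) → proj₁ (D-lipschitz k x (edge-view e))
                        ; (inj₂ e) → proj₂ (D-lipschitz k x (edge-view e)) }
      ; predecessor = ∀-vertex (λ i y m D≡1+m → δ-predecessor k x i y m (trans (sym (D-ι k x i y)) D≡1+m))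
      ; bounded     = ∀-vertex (λ i y → subst (_< V g) (sym (D-ι k x i y)) (δ-bounded k x i y)) }

    circuit-connected : Connected g
    circuit-connected = ∀-vertex (λ k x → dist-isDistanceFrom (D-isDistanceFrom k x))

    dist-ι : ∀ k x i y → dist g (ι k x) (ι i y) ≡ δ (k , x) (i , y)
    dist-ι k x i y = trans (dist-unique (D-isDistanceFrom k x) (ι i y)) (D-ι k x i y)

    dist-inner : ∀ i x y → dist g (ι i x) (ι i y) ≡ d i x y
    dist-inner i x y = trans (dist-ι i x i y) (δ-same i x y)

    dist-cross : ∀ k i x y → k ≢ i → dist g (ι k x) (ι i y) ≡ d k x (root k) + suc (d i (root i) y)
    dist-cross k i x y k≢i = trans (dist-ι k x i y) (δ-cross k i x y k≢i)

    dist-from-c : ∀ i k y → dist g (c i) (ι k y) ≡ hop i k + d k (root k) y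
    dist-from-c i k y with i ≟₃ k
    ... | yes refl = dist-inner i (root i) y
    ... | no i≢k   = trans (dist-cross i k (root i) y i≢k) (cong (λ n → n + suc (d k (root k) y)) (d-root i))

    dist-to-c : ∀ i x ρ → dist g (ι i x) (c ρ) ≡ d i x (root i) + hop i ρ
    dist-to-c i x ρ with i ≟₃ ρ
    ... | yes refl = trans (dist-inner i x (root i)) (sym (+-identityʳ _))
    ... | no i≢ρ   = trans (dist-cross i ρ x (root ρ) i≢ρ) (cong (λ n → d i x (root i) + suc n) (d-root ρ))

    ∑-parts : (f : Fin (V g) → ℕ) → ∑ f ≡ ∑₃ (λ k → ∑ (f ∘ ι k))
    ∑-parts f = trans (∑-↑ (size i₁) _ f) (cong (∑ (f ∘ ι i₁) +_)
                  (trans (∑-↑ (size i₂) _ (f ∘ (size i₁ ↑ʳ_))) (cong (∑ (f ∘ ι i₂) +_)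
                    (∑-↑ (size i₃) 0 (f ∘ (size i₁ ↑ʳ_) ∘ (size i₂ ↑ʳ_))))))

    nClose-parts : ∀ a b → nClose g a b ≡ ∑₃ (λ k → ∑ (λ w → ⟦ dist g a (ι k w) < dist g b (ι k w) ⟧))
    nClose-parts a b = trans (sum-map-allFin (V g) _) (∑-parts _)

    nClose-inner : ∀ i a b → nClose g (ι i a) (ι i b) ≡ nClose (H i) a b + (if d i a (root i) <ᵇ d i b (root i) then others i else 0)
    nClose-inner i a b = trans (nClose-parts (ι i a) (ι i b)) (∑₃-focus i _ _ _ same cross)
      where
        same : ∑ (λ w → ⟦ dist g (ι i a) (ι i w) < dist g (ι i b) (ι i w) ⟧) ≡ nClose (H i) a b
        same = trans (sum-cong-≗ (λ w → cong₂ ⟦_<_⟧ (dist-inner i a w) (dist-inner i b w))) (sym (sum-map-allFin (size i) _))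
        cross : ∀ k → k ≢ i → ∑ (λ w → ⟦ dist g (ι i a) (ι k w) < dist g (ι i b) (ι k w) ⟧)
                              ≡ (if d i a (root i) <ᵇ d i b (root i) then size k else 0)
        cross k k≢i = trans (sum-cong-≗ (λ w → cong₂ ⟦_<_⟧ (dist-cross i k a w i≢k) (dist-cross i k b w i≢k)))
                            (∑-shifted-indicator (size k) (d i a (root i)) (d i b (root i)) (λ w → suc (d k (root k) w)))
          where i≢k = λ i≡k → k≢i (sym i≡k)

    nClose-cycle : ∀ i j → i ≢ j → nClose g (c i) (c j) ≡ size i
    nClose-cycle i j i≢j = trans (nClose-parts (c i) (c j)) (trans (cong₂ _+_ (part i₁) (cong₂ _+_ (part i₂) (cong (_+ 0) (part i₃))))
                                                                   (∑₃-cycle i j i≢j))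
      where
        part : ∀ k → ∑ (λ w → ⟦ dist g (c i) (ι k w) < dist g (c j) (ι k w) ⟧) ≡ (if hop i k <ᵇ hop j k then size k else 0)
        part k = trans (sum-cong-≗ (λ w → cong₂ ⟦_<_⟧ (dist-from-c i k w) (dist-from-c j k w)))
                       (∑-shifted-indicator (size k) (hop i k) (hop j k) (d k (root k)))

    dist-c-c : ∀ i ρ → dist g (c i) (c ρ) ≡ hop i ρ
    dist-c-c i ρ = trans (dist-from-c i ρ (root ρ)) (trans (cong (hop i ρ +_) (d-root ρ)) (+-identityʳ _))

    imbalance-inner : ∀ ρ W i e → imbalanceWith g (c ρ) W (lift i e) ≡ imbalanceWith (H i) (root i) (others i + W) e
    imbalance-inner ρ W i (a , b) = cong₂ ∣_-_∣ (closer a b) (closer b a)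
      where
        merge : ∀ b N x y → N + (if b then x else 0) + (if b then y else 0) ≡ N + (if b then x + y else 0)
        merge true  N x y = +-assoc N x y
        merge false N x y = +-identityʳ (N + 0)
        closer : ∀ a b → closerWith g (c ρ) W (ι i a) (ι i b) ≡ closerWith (H i) (root i) (others i + W) a b
        closer a b =
          trans (cong₂ _+_ (nClose-inner i a b)
                  (cong (λ b → if b then W else 0)
                    (trans (cong₂ _<ᵇ_ (dist-to-c i a ρ) (dist-to-c i b ρ)) (+-cancelʳ-<ᵇ (d i a (root i)) (d i b (root i)) (hop i ρ)))))
                (merge (d i a (root i) <ᵇ d i b (root i)) _ _ _)

    imbalance-cycle : ∀ ρ W i j → i ≢ j → imbalanceWith g (c ρ) W (c i , c j) ≡ ∣ side ρ W i - side ρ W j ∣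
    imbalance-cycle ρ W i j i≢j = cong₂ ∣_-_∣ (closer i j i≢j) (closer j i (λ j≡i → i≢j (sym j≡i)))
      where
        closer : ∀ i j → i ≢ j → closerWith g (c ρ) W (c i) (c j) ≡ side ρ W i
        closer i j i≢j = cong₂ _+_ (nClose-cycle i j i≢j)
          (cong (λ b → if b then W else 0) (trans (cong₂ _<ᵇ_ (dist-c-c i ρ) (dist-c-c j ρ)) (hop-<ᵇ i j ρ i≢j)))

    mostarWith-circuit : ∀ ρ W → mostarWith g (c ρ) W ≡
      partMostar W i₁ + (partMostar W i₂ + (partMostar W i₃ + cycleImbalance ρ W))
    mostarWith-circuit ρ W = begin
        sum (map t (E g))
      ≡⟨ cong (sum ∘ map t) edges ⟩
        sum (map t (liftedEdges i₁ ++ liftedEdges i₂ ++ liftedEdges i₃ ++ cycle))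
      ≡⟨ sum-map-++ t (liftedEdges i₁) _ ⟩
        sum (map t (liftedEdges i₁)) + sum (map t (liftedEdges i₂ ++ liftedEdges i₃ ++ cycle))
      ≡⟨ cong (sum (map t (liftedEdges i₁)) +_)
           (trans (sum-map-++ t (liftedEdges i₂) _) (cong (sum (map t (liftedEdges i₂)) +_) (sum-map-++ t (liftedEdges i₃) _))) ⟩
        sum (map t (liftedEdges i₁)) + (sum (map t (liftedEdges i₂)) + (sum (map t (liftedEdges i₃)) + sum (map t cycle)))
      ≡⟨ cong₂ _+_ (part i₁) (cong₂ _+_ (part i₂) (cong₂ _+_ (part i₃) cycle-part)) ⟩
        partMostar W i₁ + (partMostar W i₂ + (partMostar W i₃ + cycleImbalance ρ W))
      ∎
      where
        open ≡-Reasoning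
        t = imbalanceWith g (c ρ) W
        part : ∀ i → sum (map t (liftedEdges i)) ≡ partMostar W i
        part i = cong sum (trans (sym (map-∘ (E (H i)))) (map-cong (imbalance-inner ρ W i) (E (H i))))
        cycle-part : sum (map t cycle) ≡ cycleImbalance ρ W
        cycle-part = cong₂ _+_ (imbalance-cycle ρ W i₁ i₂ (λ ()))
                       (cong₂ _+_ (imbalance-cycle ρ W i₂ i₃ (λ ())) (cong (_+ 0) (imbalance-cycle ρ W i₃ i₁ (λ ()))))

K1-connected : Connected (G K1)
K1-connected fz = record
  { root-zero   = refl
  ; zero⇒root   = λ { fz _ → refl }
  ; 1-lipschitz = λ { (inj₁ ()) ; (inj₂ ()) }
  ; predecessor = λ { fz _ () }
  ; bounded     = λ { fz → s≤s z≤n } }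

Gsuc-connected : ∀ k → Connected (G (Gsuc k))
-- G₁, the triangle, is definitionally the circuit of three copies of K₁.
Gsuc-connected zero    = Circuit₃.Distances.circuit-connected K1 K1 K1 K1-connected K1-connected K1-connected
Gsuc-connected (suc k) = Circuit₃.Distances.circuit-connected (Gsuc k) (Gsuc k) K1 (Gsuc-connected k) (Gsuc-connected k) K1-connected

order : ℕ → ℕ
order k = V (G (Gsuc k))

rootedMostar : ℕ → ℕ → ℕ
rootedMostar k W = mostarWith (G (Gsuc k)) (z (Gsuc k)) W

rootedMostar-zero : ∀ W → rootedMostar 0 W ≡ W + W
rootedMostar-zero W = trans (Circuit₃.Distances.mostarWith-circuit K1 K1 K1 K1-connected K1-connected K1-connected i₁ W)
                            (cong₂ _+_ (∣-∣-identityʳ W) (+-identityʳ W))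

rootedMostar-suc : ∀ k W → rootedMostar (suc k) W ≡
  rootedMostar k (order k + 1 + W) + (rootedMostar k (order k + 1 + W)
    + (0 + (∣ order k + 0 - (order k + 0) ∣ + (∣ order k + 0 - (1 + W) ∣ + (∣ 1 + W - (order k + 0) ∣ + 0)))))
rootedMostar-suc k W = Circuit₃.Distances.mostarWith-circuit (Gsuc k) (Gsuc k) K1 (Gsuc-connected k) (Gsuc-connected k) K1-connected i₃ W

mostar-T : ∀ k → Mostar (T (suc k)) ≡ 3 * rootedMostar k (order k + order k)
mostar-T k = begin
    Mostar (T (suc k))
  ≡⟨ mostar≡mostarWith-0 (T (suc k)) (Circuit₃.c (Gsuc k) (Gsuc k) (Gsuc k) i₁) ⟩
    mostarWith (T (suc k)) (Circuit₃.c (Gsuc k) (Gsuc k) (Gsuc k) i₁) 0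
  ≡⟨ Circuit₃.Distances.mostarWith-circuit (Gsuc k) (Gsuc k) (Gsuc k) (Gsuc-connected k) (Gsuc-connected k) (Gsuc-connected k) i₁ 0 ⟩
    X + (X + (X + (∣ n - n ∣ + (∣ n - n ∣ + (∣ n - n ∣ + 0)))))
  ≡⟨ cong (λ m → X + (X + (X + (m + (m + (m + 0)))))) (∣n-n∣≡0 n) ⟩
    X + (X + (X + 0))
  ≡⟨ arrange X ⟩
    3 * X
  ≡⟨ cong (λ W → 3 * rootedMostar k W) (+-identityʳ (order k + order k)) ⟩
    3 * rootedMostar k (order k + order k)
  ∎
  where
    open ≡-Reasoning
    n = order k + 0
    X = rootedMostar k (order k + order k + 0)
    arrange : ∀ x → x + (x + (x + 0)) ≡ 3 * x
    arrange = solve-∀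

slope : ℕ → ℕ
slope zero    = 2
slope (suc k) = 2 * slope k + 2

order≡1+slope : ∀ k → order k ≡ suc (slope k)
order≡1+slope zero    = refl
order≡1+slope (suc k) rewrite order≡1+slope k = arrange (slope k)
  where arrange : ∀ x → suc x + (suc x + (1 + 0)) ≡ suc (2 * x + 2)
        arrange = solve-∀

2^[k+2]≡slope+2 : ∀ k → 2 ^ (k + 2) ≡ slope k + 2
2^[k+2]≡slope+2 zero    = refl
2^[k+2]≡slope+2 (suc k) rewrite 2^[k+2]≡slope+2 k = arrange (slope k)
  where arrange : ∀ x → 2 * (x + 2) ≡ 2 * x + 2 + 2
        arrange = solve-∀

rootedMostar-suc-≤ : ∀ k W → order k ≤ suc W →
  rootedMostar (suc k) W ≡ 2 * rootedMostar k (order k + 1 + W) + 2 * (suc W ∸ order k)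
rootedMostar-suc-≤ k W order≤1+W =
  trans (rootedMostar-suc k W) (trans (arrange (rootedMostar k _) _) (cong (2 * rootedMostar k (order k + 1 + W) +_) cycle-part))
  where
    arrange : ∀ x y → x + (x + (0 + y)) ≡ 2 * x + y
    arrange = solve-∀
    double : ∀ x → x + (x + 0) ≡ 2 * x
    double = solve-∀
    cycle-part : ∣ order k + 0 - (order k + 0) ∣ + (∣ order k + 0 - (1 + W) ∣ + (∣ 1 + W - (order k + 0) ∣ + 0))
                 ≡ 2 * (suc W ∸ order k)
    cycle-part rewrite +-identityʳ (order k) | ∣n-n∣≡0 (order k)
                     | m≤n⇒∣m-n∣≡n∸m order≤1+W | m≤n⇒∣n-m∣≡n∸m order≤1+W = double (suc W ∸ order k)

rootedMostar-affine : ∀ k W e → order k ≤ W → rootedMostar k (W + e) ≡ rootedMostar k W + slope k * e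
rootedMostar-affine zero W e _ rewrite rootedMostar-zero (W + e) | rootedMostar-zero W = arrange W e
  where arrange : ∀ W e → W + e + (W + e) ≡ W + W + 2 * e
        arrange = solve-∀
rootedMostar-affine (suc k) W e order≤W = begin
    rootedMostar (suc k) (W + e)
  ≡⟨ rootedMostar-suc-≤ k (W + e) (≤-trans order≤1+W (m≤m+n (suc W) e)) ⟩
    2 * rootedMostar k (order k + 1 + (W + e)) + 2 * (suc (W + e) ∸ order k)
  ≡⟨ cong₂ (λ x y → 2 * rootedMostar k x + 2 * y) (sym (+-assoc (order k + 1) W e)) (+-∸-comm e order≤1+W) ⟩
    2 * rootedMostar k (order k + 1 + W + e) + 2 * ((suc W ∸ order k) + e)
  ≡⟨ cong (λ x → 2 * x + 2 * ((suc W ∸ order k) + e))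
          (rootedMostar-affine k (order k + 1 + W) e (≤-trans (m≤m+n (order k) 1) (m≤m+n (order k + 1) W))) ⟩
    2 * (rootedMostar k (order k + 1 + W) + slope k * e) + 2 * ((suc W ∸ order k) + e)
  ≡⟨ arrange (rootedMostar k (order k + 1 + W)) (slope k) e (suc W ∸ order k) ⟩
    (2 * rootedMostar k (order k + 1 + W) + 2 * (suc W ∸ order k)) + (2 * slope k + 2) * e
  ≡⟨ cong (_+ (2 * slope k + 2) * e) (sym (rootedMostar-suc-≤ k W order≤1+W)) ⟩
    rootedMostar (suc k) W + slope (suc k) * e
  ∎
  where
    open ≡-Reasoning
    order≤1+W : order k ≤ suc W
    order≤1+W = ≤-trans (m≤m+n (order k) _) (m≤n⇒m≤1+n order≤W)
    arrange : ∀ X A e D → 2 * (X + A * e) + 2 * (D + e) ≡ (2 * X + 2 * D) + (2 * A + 2) * e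
    arrange = solve-∀

armMostar : ℕ → ℕ
armMostar k = rootedMostar k (order k + order k)

armMostar-suc : ∀ k → armMostar (suc k) ≡ 2 * armMostar k + 6 * (slope k + 1) * (slope k + 2)
armMostar-suc k = begin
    rootedMostar (suc k) (order (suc k) + order (suc k))
  ≡⟨ rootedMostar-suc-≤ k _ order≤ ⟩
    2 * rootedMostar k (order k + 1 + (order (suc k) + order (suc k))) + 2 * (suc (order (suc k) + order (suc k)) ∸ order k)
  ≡⟨ cong₂ (λ x y → 2 * rootedMostar k x + 2 * y) argument difference ⟩
    2 * rootedMostar k ((order k + order k) + (3 * slope k + 6)) + 2 * (3 * slope k + 6)
  ≡⟨ cong (λ x → 2 * x + 2 * (3 * slope k + 6)) (rootedMostar-affine k (order k + order k) (3 * slope k + 6) (m≤m+n (order k) (order k))) ⟩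
    2 * (armMostar k + slope k * (3 * slope k + 6)) + 2 * (3 * slope k + 6)
  ≡⟨ arrange (armMostar k) (slope k) ⟩
    2 * armMostar k + 6 * (slope k + 1) * (slope k + 2)
  ∎
  where
    open ≡-Reasoning
    order≤ : order k ≤ suc (order (suc k) + order (suc k))
    order≤ = ≤-trans (m≤m+n (order k) _) (m≤n⇒m≤1+n (m≤m+n (order (suc k)) _))
    argument : order k + 1 + (order (suc k) + order (suc k)) ≡ (order k + order k) + (3 * slope k + 6)
    argument rewrite order≡1+slope (suc k) | order≡1+slope k = arrange′ (slope k)
      where arrange′ : ∀ x → suc x + 1 + (suc (2 * x + 2) + suc (2 * x + 2)) ≡ (suc x + suc x) + (3 * x + 6)
            arrange′ = solve-∀
    difference : suc (order (suc k) + order (suc k)) ∸ order k ≡ 3 * slope k + 6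
    difference rewrite order≡1+slope (suc k) | order≡1+slope k =
      trans (cong (_∸ suc (slope k)) (arrange′ (slope k))) (m+n∸m≡n (suc (slope k)) (3 * slope k + 6))
      where arrange′ : ∀ x → suc (suc (2 * x + 2) + suc (2 * x + 2)) ≡ suc x + (3 * x + 6)
            arrange′ = solve-∀
    arrange : ∀ f x → 2 * (f + x * (3 * x + 6)) + 2 * (3 * x + 6) ≡ 2 * f + 6 * (x + 1) * (x + 2)
    arrange = solve-∀

sum-applyUpTo-suc : ∀ (h : ℕ → ℕ) k → sum (applyUpTo h (suc k)) ≡ sum (applyUpTo h k) + h k
sum-applyUpTo-suc h zero    = +-identityʳ (h 0)
sum-applyUpTo-suc h (suc k) = trans (cong (h 0 +_) (sum-applyUpTo-suc (h ∘ suc) k)) (sym (+-assoc (h 0) _ _))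

sum-applyUpTo-cong : ∀ (h h′ : ℕ → ℕ) k → (∀ j → j < k → h j ≡ h′ j) → sum (applyUpTo h k) ≡ sum (applyUpTo h′ k)
sum-applyUpTo-cong h h′ zero    _  = refl
sum-applyUpTo-cong h h′ (suc k) eq =
  cong₂ _+_ (eq 0 z<s) (sum-applyUpTo-cong (h ∘ suc) (h′ ∘ suc) k (λ j j<k → eq (suc j) (s<s j<k)))

sum-applyUpTo-* : ∀ c (h : ℕ → ℕ) k → sum (applyUpTo (λ j → c * h j) k) ≡ c * sum (applyUpTo h k)
sum-applyUpTo-* c h zero    = sym (*-zeroʳ c)
sum-applyUpTo-* c h (suc k) = trans (cong (c * h 0 +_) (sum-applyUpTo-* c (h ∘ suc) k)) (sym (*-distribˡ-+ c (h 0) _))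

m∸n≡1+m∸1+n : ∀ m n → n < m → m ∸ n ≡ suc (m ∸ suc n)
m∸n≡1+m∸1+n (suc m) zero    _         = refl
m∸n≡1+m∸1+n (suc m) (suc n) (s<s n<m) = m∸n≡1+m∸1+n m n n<m

powerSum : ℕ → ℕ → ℕ
powerSum m c = sum (applyUpTo (λ t → 2 ^ (m ∸ t)) c)

powerSum-suc : ∀ m c → c ≤ m → powerSum (suc m) c ≡ 2 * powerSum m c
powerSum-suc m       zero    _         = refl
powerSum-suc (suc m) (suc c) (s≤s c≤m) =
  trans (cong (2 ^ suc (suc m) +_) (powerSum-suc m c c≤m)) (sym (*-distribˡ-+ 2 (2 ^ suc m) (powerSum m c)))

powerSum-geometric : ∀ c → powerSum (suc c) c + 4 ≡ 2 ^ (c + 2)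
powerSum-geometric zero    = refl
powerSum-geometric (suc c) = begin
    2 ^ suc (suc c) + powerSum (suc c) c + 4
  ≡⟨ +-assoc (2 ^ suc (suc c)) _ 4 ⟩
    2 ^ suc (suc c) + (powerSum (suc c) c + 4)
  ≡⟨ cong₂ _+_ (cong (2 ^_) (+-comm 2 c)) (powerSum-geometric c) ⟩
    2 ^ (c + 2) + 2 ^ (c + 2)
  ≡⟨ cong (2 ^ (c + 2) +_) (sym (+-identityʳ _)) ⟩
    2 ^ suc (c + 2)
  ∎
  where open ≡-Reasoning

powerSum-slope : ∀ k → powerSum (suc (suc k)) (suc k) ≡ 2 * slope k
powerSum-slope k = +-cancelʳ-≡ 4 _ _ (trans (powerSum-geometric (suc k)) (trans (cong (2 *_) (2^[k+2]≡slope+2 k)) (arrange (slope k))))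
  where arrange : ∀ x → 2 * (x + 2) ≡ 2 * x + 4
        arrange = solve-∀

summand : ℕ → ℕ → ℕ
summand n i = 3 * 2 ^ i * ((2 ^ (n + 2) + ∑[ 0 ⋯ i ∸ 2 ] (λ t → 2 ^ (n ∸ t))) ∸ 2 ^ (n ∸ i + 1))

closedForm : ℕ → ℕ
closedForm n = 6 * (2 ^ (n + 2) ∸ 2 ^ n) + ∑[ 2 ⋯ n ] (summand n)

summand-double : ∀ k j → j < k → summand (suc (suc k)) (2 + j) ≡ 2 * summand (suc k) (2 + j)
summand-double k j j<k rewrite powerSum-suc (suc k) (suc j) (m≤n⇒m≤1+n j<k) | m∸n≡1+m∸1+n k j j<k =
  trans (cong (3 * 2 ^ (2 + j) *_)
          (trans (cong (_∸ 2 * 2 ^ (k ∸ suc j + 1)) (sym (*-distribˡ-+ 2 (2 ^ (suc k + 2)) (powerSum (suc k) (suc j)))))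
                 (sym (*-distribˡ-∸ 2 (2 ^ (suc k + 2) + powerSum (suc k) (suc j)) (2 ^ (k ∸ suc j + 1))))))
        (arrange (2 ^ (2 + j)) _)
  where arrange : ∀ p q → 3 * p * (2 * q) ≡ 2 * (3 * p * q)
        arrange = solve-∀

summand-last : ∀ k → summand (suc (suc k)) (2 + k) ≡ 18 * (slope k + 1) * (slope k + 2)
summand-last k = begin
    summand (suc (suc k)) (2 + k)
  ≡⟨ cong₂ (λ x y → 3 * x * y) (trans (cong (2 ^_) (+-comm 2 k)) (2^[k+2]≡slope+2 k))
       (cong₂ _∸_ (cong₂ _+_ (cong (λ x → 2 * (2 * x)) (2^[k+2]≡slope+2 k)) (powerSum-slope k))
                  (cong (λ x → 2 ^ (x + 1)) (n∸n≡0 k))) ⟩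
    3 * (slope k + 2) * ((2 * (2 * (slope k + 2)) + 2 * slope k) ∸ 2)
  ≡⟨ cong (λ x → 3 * (slope k + 2) * (x ∸ 2)) (arrange₁ (slope k)) ⟩
    3 * (slope k + 2) * ((6 * slope k + 6) + 2 ∸ 2)
  ≡⟨ cong (3 * (slope k + 2) *_) (m+n∸n≡m (6 * slope k + 6) 2) ⟩
    3 * (slope k + 2) * (6 * slope k + 6)
  ≡⟨ arrange₂ (slope k) ⟩
    18 * (slope k + 1) * (slope k + 2)
  ∎
  where
    open ≡-Reasoning
    arrange₁ : ∀ x → 2 * (2 * (x + 2)) + 2 * x ≡ (6 * x + 6) + 2
    arrange₁ = solve-∀
    arrange₂ : ∀ x → 3 * (x + 2) * (6 * x + 6) ≡ 18 * (x + 1) * (x + 2)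
    arrange₂ = solve-∀

closedForm-suc : ∀ k → closedForm (suc (suc k)) ≡ 2 * closedForm (suc k) + 18 * (slope k + 1) * (slope k + 2)
closedForm-suc k = begin
    closedForm (suc (suc k))
  ≡⟨ cong₂ _+_ (cong (6 *_) (sym (*-distribˡ-∸ 2 (2 ^ (suc k + 2)) (2 ^ suc k))))
               (sum-applyUpTo-suc (λ j → summand (suc (suc k)) (2 + j)) k) ⟩
    6 * (2 * D) + (sum (applyUpTo (λ j → summand (suc (suc k)) (2 + j)) k) + summand (suc (suc k)) (2 + k))
  ≡⟨ cong₂ (λ x y → 6 * (2 * D) + (x + y))
       (trans (sum-applyUpTo-cong _ (λ j → 2 * summand (suc k) (2 + j)) k (summand-double k))
              (sum-applyUpTo-* 2 (λ j → summand (suc k) (2 + j)) k))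
       (summand-last k) ⟩
    6 * (2 * D) + (2 * sum (applyUpTo (λ j → summand (suc k) (2 + j)) k) + 18 * (slope k + 1) * (slope k + 2))
  ≡⟨ arrange D _ _ ⟩
    2 * closedForm (suc k) + 18 * (slope k + 1) * (slope k + 2)
  ∎
  where
    open ≡-Reasoning
    D = 2 ^ (suc k + 2) ∸ 2 ^ suc k
    arrange : ∀ x y z → 6 * (2 * x) + (2 * y + z) ≡ 2 * (6 * x + y) + z
    arrange = solve-∀

mostar-T≡closedForm : ∀ k → Mostar (T (suc k)) ≡ closedForm (suc k)
mostar-T≡closedForm zero    = trans (mostar-T 0) (cong (3 *_) (rootedMostar-zero 6))
mostar-T≡closedForm (suc k) = begin
    Mostar (T (suc (suc k)))
  ≡⟨ mostar-T (suc k) ⟩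
    3 * armMostar (suc k)
  ≡⟨ cong (3 *_) (armMostar-suc k) ⟩
    3 * (2 * armMostar k + 6 * (slope k + 1) * (slope k + 2))
  ≡⟨ arrange (armMostar k) (slope k) ⟩
    2 * (3 * armMostar k) + 18 * (slope k + 1) * (slope k + 2)
  ≡⟨ cong (λ x → 2 * x + 18 * (slope k + 1) * (slope k + 2)) (trans (sym (mostar-T k)) (mostar-T≡closedForm k)) ⟩
    2 * closedForm (suc k) + 18 * (slope k + 1) * (slope k + 2)
  ≡⟨ closedForm-suc k ⟨
    closedForm (suc (suc k))
  ∎
  where
    open ≡-Reasoning
    arrange : ∀ f x → 3 * (2 * f + 6 * (x + 1) * (x + 2)) ≡ 2 * (3 * f) + 18 * (x + 1) * (x + 2)
    arrange = solve-∀

mainTheorem16 : (n : ℕ) → 1 ≤ n →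
    Mostar (T n) ≡
      6 * (2 ^ (n + 2) ∸ 2 ^ n)
      + ∑[ 2 ⋯ n ] (λ i → 3 * 2 ^ i * ((2 ^ (n + 2) + ∑[ 0 ⋯ i ∸ 2 ] (λ t → 2 ^ (n ∸ t))) ∸ 2 ^ (n ∸ i + 1)))
mainTheorem16 (suc k) _ = mostar-T≡closedForm k
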